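{- There are infinitely many CS $5$-sets with sum of entries equal to zero whose entries have no common positive divisor greater than $1$.
   Context: A CS-set is a finite multiset $\langle a_1,\dots,a_n\rangle$ of integers (repeated elements allowed, order irrelevant) such that $a_1^3+a_2^3+\cdots+a_n^3=(a_1+a_2+\cdots+a_n)^2$, where it is required that no $a_i$ equals $0$ and that the multiset does not contain both $k$ and $-k$ for any integer $k$. A CS $n$-set is a CS-set with exactly $n$ elements (counted with multiplicity). -}

module Defs where

open import Data.Nat using (ℕ; _>_)
open import Data.Integer using (ℤ; +_; -_; _*_; _+_; 0ℤ)
open import Data.Integer.Divisibility using (_∣_)
open import Data.List using (List; []; _∷_; map; length)
open import Data.List.Membership.Propositional using (_∈_)
open import Data.List.Relation.Unary.All using (All)
open import Data.List.Relation.Binary.Permutation.Propositional using (_↭_)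
open import Data.Product using (_×_)
open import Relation.Binary.PropositionalEquality using (_≡_)
open import Relation.Nullary using (¬_)

-- A finite multiset of integers is represented by a list; two lists denote
-- the same multiset iff they are permutations of each other (_↭_).

sumℤ : List ℤ → ℤ
sumℤ [] = 0ℤ
sumℤ (x ∷ xs) = x + sumℤ xs

cube : ℤ → ℤ
cube a = a * a * a

IsCSSet : List ℤ → Set
IsCSSet s =
  All (λ a → ¬ a ≡ 0ℤ) s ×
  (∀ k → k ∈ s → ¬ (- k) ∈ s) ×
  sumℤ (map cube s) ≡ sumℤ s * sumℤ s

IsCSnSet : ℕ → List ℤ → Set
IsCSnSet n s = length s ≡ n × IsCSSet s

Primitive : List ℤ → Set
Primitive s = ∀ (d : ℕ) → d > 1 → ¬ All (λ a → (+ d) ∣ a) s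

-- Once a multiset has sum 0, the CS condition only asks that its cubes also sum to 0. For every n,
--   1 + b + (b + 2n + 4) = (b + n + 3) + (b + n + 2)  and  1 + b³ + (b + 2n + 4)³ = (b + n + 3)³ + (b + n + 2)³
-- with b = (n + 1)(2n + 5), so ⟨1, b, b + 2n + 4, −(b + n + 3), −(b + n + 2)⟩ is a zero-sum CS 5-set.
-- It contains 1, hence is primitive, and its largest entry exceeds n; choosing n at least the total
-- size of the entries of a given finite list of multisets yields one that is not in the list.
module Submission where

open import Defs
open import Data.Nat as ℕ using (ℕ; zero; suc; _+_; _*_; _≤_; _<_)
import Data.Nat.Properties as ℕ
open import Data.Nat.ListAction using (sum)
open import Data.Nat.Divisibility using (∣1⇒≡1)
open import Data.Nat.Tactic.RingSolver using (solve-∀)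
open import Data.Integer as ℤ using (ℤ; 0ℤ; +_; -_; ∣_∣)
import Data.Integer.Properties as ℤ
import Data.Integer.Tactic.RingSolver as ℤ-Ring
open import Data.List using (List; []; _∷_; _++_; map)
open import Data.List.Properties using (map-++; map-∘; map-cong)
open import Data.List.Membership.Propositional using (_∈_)
open import Data.List.Membership.Propositional.Properties using (∈-map⁺; ∈-map⁻; ∈-++⁻)
open import Data.List.Relation.Binary.Permutation.Propositional using (_↭_)
open import Data.List.Relation.Binary.Permutation.Propositional.Properties using (∈-resp-↭)
open import Data.List.Relation.Unary.Any using (here; there)
open import Data.List.Relation.Unary.All as All using (All; []; _∷_; lookup; tabulate)
open import Data.List.Relation.Unary.All.Properties using (++⁺; map⁺)
open import Data.Product using (Σ; _×_; _,_)
open import Data.Sum using (inj₁; inj₂)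
open import Function using (_∘_)
open import Relation.Binary.PropositionalEquality using (_≡_; _≢_; refl; sym; trans; cong; cong₂; module ≡-Reasoning)
open import Relation.Nullary using (¬_)

sumℤ-++ : ∀ xs ys → sumℤ (xs ++ ys) ≡ sumℤ xs ℤ.+ sumℤ ys
sumℤ-++ [] ys = sym (ℤ.+-identityˡ (sumℤ ys))
sumℤ-++ (x ∷ xs) ys = trans (cong (ℤ._+_ x) (sumℤ-++ xs ys)) (sym (ℤ.+-assoc x (sumℤ xs) (sumℤ ys)))

sumℤ-map-+ : ∀ ns → sumℤ (map +_ ns) ≡ + sum ns
sumℤ-map-+ [] = refl
sumℤ-map-+ (n ∷ ns) = trans (cong (ℤ._+_ (+ n)) (sumℤ-map-+ ns)) (sym (ℤ.pos-+ n (sum ns)))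

sumℤ-map-neg : ∀ xs → sumℤ (map -_ xs) ≡ - sumℤ xs
sumℤ-map-neg [] = refl
sumℤ-map-neg (x ∷ xs) = trans (cong (ℤ._+_ (- x)) (sumℤ-map-neg xs)) (sym (ℤ.neg-distrib-+ x (sumℤ xs)))

cubeℕ : ℕ → ℕ
cubeℕ n = n * n * n

cube-pos : ∀ n → cube (+ n) ≡ + cubeℕ n
cube-pos n = sym (trans (ℤ.pos-* (n * n) n) (cong (ℤ._* + n) (ℤ.pos-* n n)))

cube-neg : ∀ x → cube (- x) ≡ - cube x
cube-neg = neg³
  where
  neg³ : ∀ x → (- x) ℤ.* (- x) ℤ.* (- x) ≡ - (x ℤ.* x ℤ.* x)
  neg³ = ℤ-Ring.solve-∀

signed : List ℕ → List ℕ → List ℤ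
signed ps qs = map +_ ps ++ map -_ (map +_ qs)

sumℤ-signed : ∀ ps qs → sumℤ (signed ps qs) ≡ + sum ps ℤ.- + sum qs
sumℤ-signed ps qs = trans (sumℤ-++ (map +_ ps) _)
  (cong₂ ℤ._+_ (sumℤ-map-+ ps) (trans (sumℤ-map-neg (map +_ qs)) (cong -_ (sumℤ-map-+ qs))))

map-cube-signed : ∀ ps qs → map cube (signed ps qs) ≡ signed (map cubeℕ ps) (map cubeℕ qs)
map-cube-signed ps qs = trans (map-++ cube (map +_ ps) _) (cong₂ _++_ (map-cube-pos ps) map-cube-neg)
  where
  map-cube-pos : ∀ ns → map cube (map +_ ns) ≡ map +_ (map cubeℕ ns)
  map-cube-pos ns = trans (sym (map-∘ ns)) (trans (map-cong cube-pos ns) (map-∘ ns))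

  map-cube-neg : map cube (map -_ (map +_ qs)) ≡ map -_ (map +_ (map cubeℕ qs))
  map-cube-neg = trans (sym (map-∘ (map +_ qs)))
    (trans (map-cong cube-neg (map +_ qs)) (trans (map-∘ (map +_ qs)) (cong (map -_) (map-cube-pos qs))))

sumℤ-signed-≡0 : ∀ ps qs → sum ps ≡ sum qs → sumℤ (signed ps qs) ≡ 0ℤ
sumℤ-signed-≡0 ps qs eq = trans (sumℤ-signed ps qs)
  (trans (cong (λ m → + sum ps ℤ.- + m) (sym eq)) (ℤ.+-inverseʳ (+ sum ps)))

signed-nonzero : ∀ {ps qs} → All (_≢ 0) ps → All (_≢ 0) qs → All (_≢ 0ℤ) (signed ps qs)
signed-nonzero ps≢0 qs≢0 = ++⁺ (map⁺ (pos≢0 ps≢0)) (map⁺ (map⁺ (neg≢0 qs≢0)))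
  where
  pos≢0 : ∀ {ns} → All (_≢ 0) ns → All (λ n → + n ≢ 0ℤ) ns
  pos≢0 = All.map (λ n≢0 → n≢0 ∘ ℤ.+-injective)

  neg≢0 : ∀ {ns} → All (_≢ 0) ns → All (λ n → - + n ≢ 0ℤ) ns
  neg≢0 = All.map (λ n≢0 → n≢0 ∘ ℤ.+-injective ∘ ℤ.neg-injective)

pos≡neg⇒≡0 : ∀ {m n} → + m ≡ - + n → m ≡ 0
pos≡neg⇒≡0 {zero} _ = refl
pos≡neg⇒≡0 {suc m} {zero} ()
pos≡neg⇒≡0 {suc m} {suc n} ()

data SignedMember (ps qs : List ℕ) (k : ℤ) : Set where
  positive : ∀ {p} → p ∈ ps → k ≡ + p → SignedMember ps qs k
  negative : ∀ {q} → q ∈ qs → k ≡ - + q → SignedMember ps qs k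

signed-member : ∀ {ps qs k} → k ∈ signed ps qs → SignedMember ps qs k
signed-member {ps} k∈ with ∈-++⁻ (map +_ ps) k∈
... | inj₁ k∈⁺ with ∈-map⁻ +_ k∈⁺
...   | p , p∈ , k≡p = positive p∈ k≡p
signed-member {ps} k∈ | inj₂ k∈⁻ with ∈-map⁻ -_ k∈⁻
...   | x , x∈ , k≡-x with ∈-map⁻ +_ x∈
...     | q , q∈ , refl = negative q∈ k≡-x

Disjoint : List ℕ → List ℕ → Set
Disjoint ps qs = ∀ {p q} → p ∈ ps → q ∈ qs → p ≢ q

signed-no-opposites : ∀ {ps qs} → All (_≢ 0) ps → All (_≢ 0) qs → Disjoint ps qs →
  ∀ k → k ∈ signed ps qs → ¬ (- k) ∈ signed ps qs
signed-no-opposites ps≢0 qs≢0 disjoint k k∈ -k∈ with signed-member k∈ | signed-member -k∈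
... | positive {p} p∈ refl | positive p′∈ -p≡p′ = lookup ps≢0 p′∈ (pos≡neg⇒≡0 (sym -p≡p′))
... | positive p∈ refl | negative q∈ -p≡-q = disjoint p∈ q∈ (ℤ.+-injective (ℤ.neg-injective -p≡-q))
... | negative {q} q∈ refl | positive p∈ q≡p =
  disjoint p∈ q∈ (sym (ℤ.+-injective (trans (sym (ℤ.neg-involutive (+ q))) q≡p)))
... | negative {q} q∈ refl | negative q′∈ q≡-q′ =
  lookup qs≢0 q∈ (pos≡neg⇒≡0 (trans (sym (ℤ.neg-involutive (+ q))) q≡-q′))

signed-isCSSet : ∀ {ps qs} → All (_≢ 0) ps → All (_≢ 0) qs → Disjoint ps qs →
  sum ps ≡ sum qs → sum (map cubeℕ ps) ≡ sum (map cubeℕ qs) → IsCSSet (signed ps qs)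
signed-isCSSet {ps} {qs} ps≢0 qs≢0 disjoint sums cubeSums =
  signed-nonzero ps≢0 qs≢0 , signed-no-opposites ps≢0 qs≢0 disjoint , cubes≡square
  where
  open ≡-Reasoning

  sum≡0 : sumℤ (signed ps qs) ≡ 0ℤ
  sum≡0 = sumℤ-signed-≡0 ps qs sums

  cubes≡square : sumℤ (map cube (signed ps qs)) ≡ sumℤ (signed ps qs) ℤ.* sumℤ (signed ps qs)
  cubes≡square = begin
    sumℤ (map cube (signed ps qs))
      ≡⟨ cong sumℤ (map-cube-signed ps qs) ⟩
    sumℤ (signed (map cubeℕ ps) (map cubeℕ qs))
      ≡⟨ sumℤ-signed-≡0 (map cubeℕ ps) (map cubeℕ qs) cubeSums ⟩
    0ℤ ℤ.* 0ℤ
      ≡⟨ sym (cong₂ ℤ._*_ sum≡0 sum≡0) ⟩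
    sumℤ (signed ps qs) ℤ.* sumℤ (signed ps qs)
      ∎

1∈⇒Primitive : ∀ {s} → + 1 ∈ s → Primitive s
1∈⇒Primitive 1∈s d d>1 d∣s with ∣1⇒≡1 (lookup d∣s 1∈s)
... | refl = ℕ.<-irrefl refl d>1

∈⇒≤sum : ∀ {n ns} → n ∈ ns → n ≤ sum ns
∈⇒≤sum {n} {_ ∷ ns} (here refl) = ℕ.m≤m+n n (sum ns)
∈⇒≤sum {n} {m ∷ ns} (there n∈) = ℕ.≤-trans (∈⇒≤sum n∈) (ℕ.m≤n+m (sum ns) m)

normBound : List (List ℤ) → ℕ
normBound = sum ∘ map (sum ∘ map ∣_∣)

∣∣≤normBound : ∀ {x t known} → x ∈ t → t ∈ known → ∣ x ∣ ≤ normBound known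
∣∣≤normBound x∈t t∈known =
  ℕ.≤-trans (∈⇒≤sum (∈-map⁺ ∣_∣ x∈t)) (∈⇒≤sum (∈-map⁺ (sum ∘ map ∣_∣) t∈known))

large∈⇒All¬↭ : ∀ {x s} known → x ∈ s → normBound known < ∣ x ∣ → All (λ t → ¬ (s ↭ t)) known
large∈⇒All¬↭ known x∈s large =
  tabulate λ t∈known s↭t → ℕ.<⇒≱ large (∣∣≤normBound (∈-resp-↭ s↭t x∈s) t∈known)

module _ (n : ℕ) where
  private
    b p q₁ q₂ : ℕ
    b  = 5 + n * (7 + 2 * n)
    p  = (4 + (n + n)) + b
    q₁ = (3 + n) + b
    q₂ = (2 + n) + b

    b<q₂ : b < q₂
    b<q₂ = ℕ.m<n+m b {2 + n} ℕ.z<s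

    q₂<q₁ : q₂ < q₁
    q₂<q₁ = ℕ.n<1+n q₂

    q₁<p : q₁ < p
    q₁<p = ℕ.+-monoˡ-< b (ℕ.+-monoʳ-≤ 4 (ℕ.m≤m+n n n))

  positives negatives : List ℕ
  positives = 1 ∷ b ∷ p ∷ []
  negatives = q₁ ∷ q₂ ∷ []

  family : List ℤ
  family = signed positives negatives

  positives-nonzero : All (_≢ 0) positives
  positives-nonzero = (λ ()) ∷ (λ ()) ∷ (λ ()) ∷ []

  negatives-nonzero : All (_≢ 0) negatives
  negatives-nonzero = (λ ()) ∷ (λ ()) ∷ []

  positives-disjoint-negatives : Disjoint positives negatives
  positives-disjoint-negatives (here refl)                 (here refl)         = λ ()
  positives-disjoint-negatives (here refl)                 (there (here refl)) = λ ()
  positives-disjoint-negatives (there (here refl))         (here refl)         = ℕ.<⇒≢ (ℕ.<-trans b<q₂ q₂<q₁)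
  positives-disjoint-negatives (there (here refl))         (there (here refl)) = ℕ.<⇒≢ b<q₂
  positives-disjoint-negatives (there (there (here refl))) (here refl)         = ℕ.>⇒≢ q₁<p
  positives-disjoint-negatives (there (there (here refl))) (there (here refl)) = ℕ.>⇒≢ (ℕ.<-trans q₂<q₁ q₁<p)

  n<largest-entry : n < p
  n<largest-entry = ℕ.<-≤-trans (ℕ.m<n+m n {4} ℕ.z<s)
    (ℕ.≤-trans (ℕ.+-monoʳ-≤ 4 (ℕ.m≤m+n n n)) (ℕ.m≤m+n _ b))

positives-sum : ∀ n → sum (positives n) ≡ sum (negatives n)
positives-sum = identity
  where
  identity : ∀ n → let b = 5 + n * (7 + 2 * n) in
    1 + (b + ((4 + (n + n)) + b + 0)) ≡ (3 + n) + b + ((2 + n) + b + 0)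
  identity = solve-∀

positives-cube-sum : ∀ n → sum (map cubeℕ (positives n)) ≡ sum (map cubeℕ (negatives n))
positives-cube-sum = identity
  where
  identity : ∀ n → let b = 5 + n * (7 + 2 * n) ; p = (4 + (n + n)) + b
                       q₁ = (3 + n) + b ; q₂ = (2 + n) + b in
    1 * 1 * 1 + (b * b * b + (p * p * p + 0)) ≡ q₁ * q₁ * q₁ + (q₂ * q₂ * q₂ + 0)
  identity = solve-∀

family-isCSSet : ∀ n → IsCSSet (family n)
family-isCSSet n = signed-isCSSet (positives-nonzero n) (negatives-nonzero n)
  (positives-disjoint-negatives n) (positives-sum n) (positives-cube-sum n)

proposition7 : (known : List (List ℤ)) →
    Σ (List ℤ) (λ s → IsCSnSet 5 s × sumℤ s ≡ 0ℤ × Primitive s × All (λ t → ¬ (s ↭ t)) known)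
proposition7 known =
  family n ,
  (refl , family-isCSSet n) ,
  sumℤ-signed-≡0 (positives n) (negatives n) (positives-sum n) ,
  1∈⇒Primitive (here refl) ,
  large∈⇒All¬↭ known (there (there (here refl))) (n<largest-entry n)
  where
  n = normBound known
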